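{- The following randomized online rounding algorithm is well defined: on the arrival of every vertex $v$, the values $\{z_u\}_{u\in N_v(v)}$ form a valid probability distribution, i.e. $z_u\ge 0$ and $\sum_{u\in N_v(v)} z_u\leq 1$. Moreover, for each $v$ and each $u\in N_v(v)$, the algorithm matches edge $\{u,v\}$ with probability exactly $x_{uv}$.
   Context: Setting: online matching under general vertex arrivals. Vertices $v_1,v_2,\dots,v_n$ arrive one at a time; when $v$ arrives, its edges to previously arrived neighbors are revealed. $N_v(u)$ denotes the set of neighbors of $u$ that arrive before $v$, and $x^+:=\max\{0,x\}$. The fractional (primal-dual) algorithm, with parameters $f(\theta)=1-\theta$ and $\beta=2$, works as follows: initially $y_u\gets 0$ for all $u$ and $x_{uv}\gets 0$ for all $u,v$. On arrival of $v$, choose the largest $\theta\le 1$ such that $\sum_{u\in N_v(v)}(\theta-y_u)^+\le f(\theta)$; then for each $u\in N_v(v)$ set $x_{uv}\gets \frac{(\theta-y_u)^+}{\beta}\left(1+\frac{1-\theta}{f(\theta)}\right)$ and $y_u\gets\max\{y_u,\theta\}$; finally set $y_v\gets 1-\theta$. The rounding algorithm starts with $M\gets\emptyset$ and, on the arrival of each vertex $v$: updates the $y_u$'s and $x_{uv}$'s using this fractional algorithm with $\beta=2$ and $f(\theta)=1-\theta$; for each $u\in N_v(v)$ sets $z_u\gets x_{uv}/\Pr[u\text{ is free (unmatched in }M)\text{ when }v\text{ arrives}]$; samples at most one neighbor $u\in N_v(v)$, each $u$ with probability $z_u$; and if a sampled neighbor $u$ is free, adds $\{u,v\}$ to $M$.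 -}

module Defs where

open import Data.Nat as ℕ using (ℕ; zero; suc)
open import Data.Rational using (ℚ; 0ℚ; 1ℚ; _+_; _*_; _-_; _⊔_; _≤_; 1/_; ≢-nonZero)
open import Data.Rational.Properties using (_≟_)
open import Data.List using (List; []; _∷_; map; foldr; concatMap)
open import Data.Bool.ListAction using (any)
open import Data.List.Membership.Propositional using (_∈_)
open import Data.List.Membership.DecPropositional ℕ._≟_ using (_∈?_)
open import Data.Product using (_×_; _,_; proj₁; proj₂)
open import Data.Bool using (Bool; true; false; if_then_else_; not; _∨_; _∧_)
open import Relation.Nullary using (yes; no)
open import Relation.Nullary.Decidable using (⌊_⌋)

-- An instance of online matching under general vertex arrivals:
-- vertices are 0,1,2,... in arrival order, and  nbr v  lists the
-- neighbours of v that arrive before v (i.e. N_v(v)).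
Arrivals : Set
Arrivals = ℕ → List ℕ

_⁺ : ℚ → ℚ
x ⁺ = 0ℚ ⊔ x

-- total division on ℚ (p ÷₀ 0 = 0); only used where the paper's
-- expression has a 0/0 that is multiplied by 0 or is a probability ratio.
_÷₀_ : ℚ → ℚ → ℚ
p ÷₀ q with q ≟ 0ℚ
... | yes _ = 0ℚ
... | no q≢0 = p * 1/_ q {{≢-nonZero q≢0}}

sumℚ : List ℚ → ℚ
sumℚ = foldr _+_ 0ℚ

½ : ℚ
½ = 1/_ (1ℚ + 1ℚ)

f : ℚ → ℚ
f θ = 1ℚ - θ

-- yAt nbr θ t u : value of y_u just before vertex t arrives.
yAt : Arrivals → (ℕ → ℚ) → ℕ → ℕ → ℚ
yAt nbr θ zero u = 0ℚ
yAt nbr θ (suc t) u with u ∈? nbr t | u ℕ.≟ t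
... | yes _ | _     = yAt nbr θ t u ⊔ θ t
... | no _  | yes _ = 1ℚ - θ t
... | no _  | no _  = yAt nbr θ t u

Feasible : Arrivals → (ℕ → ℚ) → ℕ → ℚ → Set
Feasible nbr θ t θ' = sumℚ (map (λ u → (θ' - yAt nbr θ t u) ⁺) (nbr t)) ≤ f θ'

IsLargestθ : Arrivals → (ℕ → ℚ) → ℕ → Set
IsLargestθ nbr θ t =
  (θ t ≤ 1ℚ) × Feasible nbr θ t (θ t) ×
  (∀ θ' → θ' ≤ 1ℚ → Feasible nbr θ t θ' → θ' ≤ θ t)

-- x_{uv} as set on the arrival of v (β = 2)
xval : Arrivals → (ℕ → ℚ) → ℕ → ℕ → ℚ
xval nbr θ u v =
  ((θ v - yAt nbr θ v u) ⁺ * ½) * (1ℚ + ((1ℚ - θ v) ÷₀ f (θ v)))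

-- a matching is a list of edges (u , v) with u arriving before v
Matching : Set
Matching = List (ℕ × ℕ)

Dist : Set
Dist = List (ℚ × Matching)

isFree : ℕ → Matching → Bool
isFree u M = not (any (λ e → ⌊ proj₁ e ℕ.≟ u ⌋ ∨ ⌊ proj₂ e ℕ.≟ u ⌋) M)

hasEdge : ℕ → ℕ → Matching → Bool
hasEdge u v M = any (λ e → ⌊ proj₁ e ℕ.≟ u ⌋ ∧ ⌊ proj₂ e ℕ.≟ v ⌋) M

Pr : Dist → (Matching → Bool) → ℚ
Pr D E = sumℚ (map (λ pM → if E (proj₂ pM) then proj₁ pM else 0ℚ) D)

mutual
  -- distribution of M just before vertex t arrives
  distAt : Arrivals → (ℕ → ℚ) → ℕ → Dist
  distAt nbr θ zero = (1ℚ , []) ∷ []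
  distAt nbr θ (suc t) = concatMap step (distAt nbr θ t)
    where
    zs : List (ℕ × ℚ)
    zs = map (λ u → (u , zval nbr θ t u)) (nbr t)
    step : ℚ × Matching → Dist
    step (p , M) =
      (p * (1ℚ - sumℚ (map proj₂ zs)) , M) ∷
      map (λ uz → (p * proj₂ uz ,
                   (if isFree (proj₁ uz) M then (proj₁ uz , t) ∷ M else M))) zs

  zval : Arrivals → (ℕ → ℚ) → ℕ → ℕ → ℚ
  zval nbr θ t u = xval nbr θ u t ÷₀ Pr (distAt nbr θ t) (isFree u)

-- By maximality of θ the fractional algorithm keeps its constraint tight,
-- Σ_{u ∈ N_v(v)} (θ − y_u)⁺ = 1 − θ, so that x_{uv} = (θ − y_u)⁺.  By induction on t,
-- the rounding algorithm keeps Pr[u is free when t arrives] = 1 − y_u: a neighbour u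
-- of t stays free with probability 1 − z_u, i.e. loses x_{ut} = (θ − y_u)⁺, turning
-- 1 − y_u into 1 − max(y_u, θ), and t itself stays free with probability
-- 1 − Σ_w x_{wt} = θ = 1 − y_t.  Hence z_u = x_{uv}/(1 − y_u): it vanishes unless
-- y_u < θ, and then z_u (1 − θ) ≤ x_{uv}, so Σ z_u ≤ 1.  The edge {u,v} is added on
-- the arrival of v with probability z_u · Pr[u free] = x_{uv}, and never later.
module Submission where

open import Defs
open import Data.Bool using (Bool; true; false; if_then_else_; not)
open import Data.Empty using (⊥-elim)
open import Data.Nat as ℕ using (ℕ; zero; suc; _<_)
import Data.Nat.Properties as ℕ
open import Data.List using (List; []; _∷_; map; _++_; concat; concatMap)
open import Data.List.Properties using (map-∘; map-cong; map-++)
open import Data.List.Membership.Propositional using (_∈_)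
open import Data.List.Membership.DecPropositional ℕ._≟_ using (_∈?_)
open import Data.List.Relation.Unary.Any using (here; there)
open import Data.List.Relation.Unary.All as All using (All; []; _∷_)
open import Data.List.Relation.Unary.All.Properties using (map⁺; concat⁺)
open import Data.List.Relation.Unary.AllPairs using (_∷_)
open import Data.List.Relation.Unary.Unique.Propositional using (Unique)
open import Data.Product using (_×_; _,_; proj₁; proj₂; ∃)
open import Data.Rational
  using (ℚ; 0ℚ; 1ℚ; _≤_; _+_; _*_; _-_; -_; _⊔_; 1/_; positive; nonNegative; ≢-nonZero)
  renaming (_<_ to _<ℚ_)
open import Data.Rational.Properties
open import Data.Sum using (_⊎_; inj₁; inj₂)
open import Relation.Binary.Definitions using (tri<; tri≈; tri>)
open import Relation.Binary.PropositionalEquality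
open import Relation.Nullary using (Dec; yes; no; ¬_)
open import Relation.Nullary.Decidable using (dec⇒maybe)
open import Tactic.RingSolver using (solve-∀)
open import Tactic.RingSolver.Core.AlmostCommutativeRing using (AlmostCommutativeRing; fromCommutativeRing)

private variable
  A B : Set

ℚ-ring : AlmostCommutativeRing _ _
ℚ-ring = fromCommutativeRing +-*-commutativeRing (λ q → dec⇒maybe (0ℚ ≟ q))

sumℚ-++ : ∀ xs ys → sumℚ (xs ++ ys) ≡ sumℚ xs + sumℚ ys
sumℚ-++ [] ys = sym (+-identityˡ _)
sumℚ-++ (x ∷ xs) ys = trans (cong (x +_) (sumℚ-++ xs ys)) (sym (+-assoc x _ _))

sumℚ-map-cong : {f g : A → ℚ} {xs : List A} →
  All (λ x → f x ≡ g x) xs → sumℚ (map f xs) ≡ sumℚ (map g xs)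
sumℚ-map-cong [] = refl
sumℚ-map-cong (e ∷ es) = cong₂ _+_ e (sumℚ-map-cong es)

sumℚ-map-cong′ : {f g : A → ℚ} (xs : List A) →
  (∀ x → f x ≡ g x) → sumℚ (map f xs) ≡ sumℚ (map g xs)
sumℚ-map-cong′ xs f≗g = sumℚ-map-cong (All.universal f≗g xs)

sumℚ-map-zero : (xs : List A) → sumℚ (map (λ _ → 0ℚ) xs) ≡ 0ℚ
sumℚ-map-zero [] = refl
sumℚ-map-zero (x ∷ xs) = trans (+-identityˡ _) (sumℚ-map-zero xs)

sumℚ-map-+ : (f g : A → ℚ) (xs : List A) →
  sumℚ (map (λ x → f x + g x) xs) ≡ sumℚ (map f xs) + sumℚ (map g xs)
sumℚ-map-+ f g [] = refl
sumℚ-map-+ f g (x ∷ xs) =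
  trans (cong (f x + g x +_) (sumℚ-map-+ f g xs)) (interchange (f x) (g x) _ _)
  where
  interchange : ∀ a b c d → (a + b) + (c + d) ≡ (a + c) + (b + d)
  interchange = solve-∀ ℚ-ring

sumℚ-map-- : (f g : A → ℚ) (xs : List A) →
  sumℚ (map (λ x → f x - g x) xs) ≡ sumℚ (map f xs) - sumℚ (map g xs)
sumℚ-map-- f g [] = refl
sumℚ-map-- f g (x ∷ xs) =
  trans (cong (f x - g x +_) (sumℚ-map-- f g xs)) (interchange (f x) (g x) _ _)
  where
  interchange : ∀ a b c d → (a - b) + (c - d) ≡ (a + c) - (b + d)
  interchange = solve-∀ ℚ-ring

sumℚ-map-*ˡ : (c : ℚ) (f : A → ℚ) (xs : List A) →
  sumℚ (map (λ x → c * f x) xs) ≡ c * sumℚ (map f xs)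
sumℚ-map-*ˡ c f [] = sym (*-zeroʳ c)
sumℚ-map-*ˡ c f (x ∷ xs) =
  trans (cong (c * f x +_) (sumℚ-map-*ˡ c f xs)) (sym (*-distribˡ-+ c (f x) _))

sumℚ-map-swap : (F : A → B → ℚ) (xs : List A) (ys : List B) →
  sumℚ (map (λ x → sumℚ (map (F x) ys)) xs) ≡ sumℚ (map (λ y → sumℚ (map (λ x → F x y) xs)) ys)
sumℚ-map-swap F [] ys = sym (sumℚ-map-zero ys)
sumℚ-map-swap F (x ∷ xs) ys =
  trans (cong (sumℚ (map (F x) ys) +_) (sumℚ-map-swap F xs ys))
        (sym (sumℚ-map-+ (F x) (λ y → sumℚ (map (λ x → F x y) xs)) ys))

sumℚ-map-mono-≤ : {f g : A → ℚ} {xs : List A} →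
  All (λ x → f x ≤ g x) xs → sumℚ (map f xs) ≤ sumℚ (map g xs)
sumℚ-map-mono-≤ [] = ≤-refl
sumℚ-map-mono-≤ (e ∷ es) = +-mono-≤ e (sumℚ-map-mono-≤ es)

sumℚ-map-nonNeg : {f : A → ℚ} {xs : List A} →
  All (λ x → 0ℚ ≤ f x) xs → 0ℚ ≤ sumℚ (map f xs)
sumℚ-map-nonNeg [] = ≤-refl
sumℚ-map-nonNeg (e ∷ es) = +-mono-≤ e (sumℚ-map-nonNeg es)

sumℚ-map-nonNeg-≤0 : {f : A → ℚ} {xs : List A} →
  All (λ x → 0ℚ ≤ f x) xs → sumℚ (map f xs) ≤ 0ℚ → All (λ x → f x ≡ 0ℚ) xs
sumℚ-map-nonNeg-≤0 [] _ = []
sumℚ-map-nonNeg-≤0 {f = f} {x ∷ xs} (0≤fx ∷ 0≤fxs) sum≤0 =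
  ≤-antisym (≤-trans fx≤sum sum≤0) 0≤fx ∷ sumℚ-map-nonNeg-≤0 0≤fxs (≤-trans rest≤sum sum≤0)
  where
  fx≤sum : f x ≤ f x + sumℚ (map f xs)
  fx≤sum = subst (_≤ f x + _) (+-identityʳ (f x)) (+-monoʳ-≤ (f x) (sumℚ-map-nonNeg 0≤fxs))
  rest≤sum : sumℚ (map f xs) ≤ f x + sumℚ (map f xs)
  rest≤sum = subst (_≤ f x + sumℚ (map f xs)) (+-identityˡ _) (+-monoˡ-≤ (sumℚ (map f xs)) 0≤fx)

sumℚ-map-≡-except : (h g : A → ℚ) {u : A} (xs : List A) → Unique xs → u ∈ xs →
  (∀ x → x ≢ u → h x ≡ g x) → sumℚ (map h xs) ≡ sumℚ (map g xs) - g u + h u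
sumℚ-map-≡-except h g (x ∷ xs) (x∉xs ∷ _) (here refl) h≡g =
  trans (cong (h x +_) (sumℚ-map-cong (All.map (λ x≢y → h≡g _ (λ y≡x → x≢y (sym y≡x))) x∉xs)))
        (shift (h x) (g x) _)
  where
  shift : ∀ a b c → a + c ≡ (b + c) - b + a
  shift = solve-∀ ℚ-ring
sumℚ-map-≡-except h g (x ∷ xs) (x∉xs ∷ xs-unique) (there u∈xs) h≡g =
  trans (cong₂ _+_ (h≡g x (λ x≡u → All.lookup x∉xs u∈xs x≡u))
                   (sumℚ-map-≡-except h g xs xs-unique u∈xs h≡g))
        (shift (g x) _ _ _)
  where
  shift : ∀ a b c d → a + (b - c + d) ≡ (a + b) - c + d
  shift = solve-∀ ℚ-ring

≤⇒0≤- : ∀ {a b} → a ≤ b → 0ℚ ≤ b - a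
≤⇒0≤- {a} {b} a≤b = subst (_≤ b - a) (+-inverseʳ a) (+-monoˡ-≤ (- a) a≤b)

<⇒0<- : ∀ {a b} → a <ℚ b → 0ℚ <ℚ b - a
<⇒0<- {a} {b} a<b = subst (_<ℚ b - a) (+-inverseʳ a) (+-monoˡ-< (- a) a<b)

≤⇒-≤0 : ∀ {a b} → a ≤ b → a - b ≤ 0ℚ
≤⇒-≤0 {a} {b} a≤b = subst (a - b ≤_) (+-inverseʳ b) (+-monoˡ-≤ (- b) a≤b)

0≤-⇒≤ : ∀ {a b} → 0ℚ ≤ b - a → a ≤ b
0≤-⇒≤ {a} {b} 0≤b-a = subst₂ _≤_ (+-identityˡ a) (b-a+a≡b a b) (+-monoˡ-≤ a 0≤b-a)
  where
  b-a+a≡b : ∀ a b → b - a + a ≡ b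
  b-a+a≡b = solve-∀ ℚ-ring

≤⇒≡⊎< : ∀ {a b} → a ≤ b → a ≡ b ⊎ a <ℚ b
≤⇒≡⊎< {a} {b} a≤b with <-cmp a b
... | tri< a<b _ _ = inj₂ a<b
... | tri≈ _ a≡b _ = inj₁ a≡b
... | tri> _ _ a>b = ⊥-elim (<-irrefl refl (<-≤-trans a>b a≤b))

⁺-nonNeg : ∀ x → 0ℚ ≤ x ⁺
⁺-nonNeg x = p≤p⊔q 0ℚ x

nonPos⇒⁺≡0 : ∀ {x} → x ≤ 0ℚ → x ⁺ ≡ 0ℚ
nonPos⇒⁺≡0 = p≥q⇒p⊔q≡p

nonNeg⇒⁺≡id : ∀ {x} → 0ℚ ≤ x → x ⁺ ≡ x
nonNeg⇒⁺≡id = p≤q⇒p⊔q≡q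

⁺-+-≤ : ∀ x ε → 0ℚ ≤ ε → (x + ε) ⁺ ≤ x ⁺ + ε
⁺-+-≤ x ε 0≤ε = ⊔-lub
  (subst (_≤ x ⁺ + ε) (+-identityˡ 0ℚ) (+-mono-≤ (⁺-nonNeg x) 0≤ε))
  (+-monoˡ-≤ ε (p≤q⊔p 0ℚ x))

c-y-[θ-y]⁺≡c-y⊔θ : ∀ c y θ′ → (c - y) - (θ′ - y) ⁺ ≡ c - (y ⊔ θ′)
c-y-[θ-y]⁺≡c-y⊔θ c y θ′ with ≤-total y θ′
... | inj₁ y≤θ′ rewrite nonNeg⇒⁺≡id (≤⇒0≤- y≤θ′) | p≤q⇒p⊔q≡q y≤θ′ = cancel c y θ′
  where
  cancel : ∀ c y θ′ → (c - y) - (θ′ - y) ≡ c - θ′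
  cancel = solve-∀ ℚ-ring
... | inj₂ θ′≤y rewrite nonPos⇒⁺≡0 (≤⇒-≤0 θ′≤y) | p≥q⇒p⊔q≡p θ′≤y = +-identityʳ (c - y)

÷₀-zeroˡ : ∀ q → 0ℚ ÷₀ q ≡ 0ℚ
÷₀-zeroˡ q with q ≟ 0ℚ
... | yes _ = refl
... | no q≢0 = *-zeroˡ (1/_ q {{≢-nonZero q≢0}})

÷₀-self : ∀ {q} → q ≢ 0ℚ → q ÷₀ q ≡ 1ℚ
÷₀-self {q} q≢0 with q ≟ 0ℚ
... | yes q≡0 = ⊥-elim (q≢0 q≡0)
... | no q≢0′ = *-inverseʳ q {{≢-nonZero q≢0′}}

÷₀-*-cancel : ∀ p q → (q ≡ 0ℚ → p ≡ 0ℚ) → (p ÷₀ q) * q ≡ p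
÷₀-*-cancel p q p≡0-if-q≡0 with q ≟ 0ℚ
... | yes q≡0 = trans (*-zeroˡ q) (sym (p≡0-if-q≡0 q≡0))
... | no q≢0 = trans (*-assoc p _ q)
  (trans (cong (p *_) (*-inverseˡ q {{≢-nonZero q≢0}})) (*-identityʳ p))

÷₀-nonNeg : ∀ {p q} → 0ℚ ≤ p → 0ℚ ≤ q → 0ℚ ≤ p ÷₀ q
÷₀-nonNeg {p} {q} 0≤p 0≤q with q ≟ 0ℚ
... | yes _ = ≤-refl
... | no q≢0 = nonNegative⁻¹ (p * 1/q) {{nonNeg*nonNeg⇒nonNeg p {{nonNegative 0≤p}} 1/q {{1/q-nonNeg}}}}
  where
  1/q = 1/_ q {{≢-nonZero q≢0}}
  1/q-nonNeg = pos⇒nonNeg 1/q {{1/pos⇒pos q {{nonNeg∧nonZero⇒pos q {{nonNegative 0≤q}} {{≢-nonZero q≢0}}}}}}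

excess : (A → ℚ) → List A → ℚ → ℚ
excess y xs a = sumℚ (map (λ u → (a - y u) ⁺) xs)

excess-nonNeg : (y : A → ℚ) (xs : List A) (a : ℚ) → 0ℚ ≤ excess y xs a
excess-nonNeg y xs a = sumℚ-map-nonNeg (All.universal (λ u → ⁺-nonNeg (a - y u)) xs)

excess-+-≤ : (y : A → ℚ) (xs : List A) (a ε : ℚ) → 0ℚ ≤ ε →
  excess y xs (a + ε) ≤ excess y xs a + ε * sumℚ (map (λ _ → 1ℚ) xs)
excess-+-≤ y xs a ε 0≤ε = ≤-trans
  (sumℚ-map-mono-≤ (All.universal termwise xs))
  (≤-reflexive (trans (sumℚ-map-+ (λ u → (a - y u) ⁺) (λ _ → ε) xs)
    (cong (excess y xs a +_)
      (trans (sumℚ-map-cong′ xs (λ _ → sym (*-identityʳ ε))) (sumℚ-map-*ˡ ε (λ _ → 1ℚ) xs)))))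
  where
  reorder : ∀ a ε y → (a + ε) - y ≡ (a - y) + ε
  reorder = solve-∀ ℚ-ring
  termwise : ∀ u → ((a + ε) - y u) ⁺ ≤ (a - y u) ⁺ + ε
  termwise u = subst (λ x → x ⁺ ≤ (a - y u) ⁺ + ε) (sym (reorder a ε (y u))) (⁺-+-≤ (a - y u) ε 0≤ε)

-- Raise a by ε = d / (1 + K), where d is the slack; then S grows by at most ε K = d − ε.
slack⇒larger-feasible : (S : ℚ → ℚ) (K a : ℚ) → 0ℚ ≤ K → 0ℚ ≤ S a →
  (∀ ε → 0ℚ ≤ ε → S (a + ε) ≤ S a + ε * K) → S a <ℚ 1ℚ - a →
  ∃ λ b → a <ℚ b × b ≤ 1ℚ × S b ≤ 1ℚ - b
slack⇒larger-feasible S K a 0≤K 0≤Sa growth slack = a + ε , a<a+ε , a+ε≤1 , feasible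
  where
  d = (1ℚ - a) - S a
  c = 1ℚ + K
  0<c : 0ℚ <ℚ c
  0<c = <-≤-trans (positive⁻¹ 1ℚ) (subst (_≤ c) (+-identityʳ 1ℚ) (+-monoʳ-≤ 1ℚ 0≤K))
  instance
    c-pos = positive 0<c
    c-nonZero = pos⇒nonZero c
    d-pos = positive (<⇒0<- slack)
  ε = d * 1/_ c
  0<ε : 0ℚ <ℚ ε
  0<ε = positive⁻¹ ε {{pos*pos⇒pos d (1/_ c) {{1/pos⇒pos c}}}}
  cε≡d : c * ε ≡ d
  cε≡d = trans (*-comm c ε) (trans (*-assoc d (1/_ c) c) (trans (cong (d *_) (*-inverseˡ c)) (*-identityʳ d)))
  split : ∀ a ε s k → 1ℚ - (a + ε) ≡ (((1ℚ - a) - s) - (1ℚ + k) * ε) + (s + ε * k)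
  split = solve-∀ ℚ-ring
  room : 1ℚ - (a + ε) ≡ S a + ε * K
  room = trans (split a ε (S a) K)
    (trans (cong (λ w → (d - w) + (S a + ε * K)) cε≡d)
      (trans (cong (_+ (S a + ε * K)) (+-inverseʳ d)) (+-identityˡ _)))
  feasible : S (a + ε) ≤ 1ℚ - (a + ε)
  feasible = ≤-trans (growth ε (<⇒≤ 0<ε)) (≤-reflexive (sym room))
  0≤εK : 0ℚ ≤ ε * K
  0≤εK = nonNegative⁻¹ (ε * K) {{nonNeg*nonNeg⇒nonNeg ε {{pos⇒nonNeg ε {{positive 0<ε}}}} K {{nonNegative 0≤K}}}}
  a+ε≤1 : a + ε ≤ 1ℚ
  a+ε≤1 = 0≤-⇒≤ (subst (0ℚ ≤_) (sym room) (subst (_≤ S a + ε * K) (+-identityˡ 0ℚ) (+-mono-≤ 0≤Sa 0≤εK)))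
  a<a+ε : a <ℚ a + ε
  a<a+ε = subst (_<ℚ a + ε) (+-identityʳ a) (+-monoʳ-< a 0<ε)

tryMatch : ℕ → ℕ → Matching → Matching
tryMatch u t M = if isFree u M then (u , t) ∷ M else M

isFree-∷ : ∀ u a b M → a ≢ u → b ≢ u → isFree u ((a , b) ∷ M) ≡ isFree u M
isFree-∷ u a b M a≢u b≢u with a ℕ.≟ u | b ℕ.≟ u
... | yes a≡u | _ = ⊥-elim (a≢u a≡u)
... | no _ | yes b≡u = ⊥-elim (b≢u b≡u)
... | no _ | no _ = refl

isFree-tryMatch-other : ∀ u w t M → w ≢ u → t ≢ u → isFree u (tryMatch w t M) ≡ isFree u M
isFree-tryMatch-other u w t M w≢u t≢u with isFree w M
... | true = isFree-∷ u w t M w≢u t≢u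
... | false = refl

isFree-tryMatch-self : ∀ u t M → isFree u (tryMatch u t M) ≡ false
isFree-tryMatch-self u t M with isFree u M in free
... | false = free
... | true with u ℕ.≟ u
...   | yes _ = refl
...   | no u≢u = ⊥-elim (u≢u refl)

isFree-tryMatch-matched : ∀ u t M → isFree u M ≡ false → t ≢ u →
  ∀ w → isFree u (tryMatch w t M) ≡ false
isFree-tryMatch-matched u t M matched t≢u w with w ℕ.≟ u
... | yes refl = isFree-tryMatch-self u t M
... | no w≢u = trans (isFree-tryMatch-other u w t M w≢u t≢u) matched

isFree-tryMatch-arrival : ∀ w t M → isFree t M ≡ true → isFree t (tryMatch w t M) ≡ not (isFree w M)
isFree-tryMatch-arrival w t M free with isFree w M
... | false = free
... | true with w ℕ.≟ t | t ℕ.≟ t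
...   | yes _ | _ = refl
...   | no _ | yes _ = refl
...   | no _ | no t≢t = ⊥-elim (t≢t refl)

hasEdge-∷ : ∀ u v a b M → a ≢ u ⊎ b ≢ v → hasEdge u v ((a , b) ∷ M) ≡ hasEdge u v M
hasEdge-∷ u v a b M other with a ℕ.≟ u | b ℕ.≟ v | other
... | no _ | _ | _ = refl
... | yes _ | no _ | _ = refl
... | yes a≡u | yes _ | inj₁ a≢u = ⊥-elim (a≢u a≡u)
... | yes _ | yes b≡v | inj₂ b≢v = ⊥-elim (b≢v b≡v)

hasEdge-tryMatch-other : ∀ u v w t M → w ≢ u ⊎ t ≢ v → hasEdge u v (tryMatch w t M) ≡ hasEdge u v M
hasEdge-tryMatch-other u v w t M other with isFree w M
... | true = hasEdge-∷ u v w t M other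
... | false = refl

hasEdge-tryMatch-self : ∀ u v M → hasEdge u v M ≡ false → hasEdge u v (tryMatch u v M) ≡ isFree u M
hasEdge-tryMatch-self u v M absent with isFree u M
... | false = absent
... | true with u ℕ.≟ u | v ℕ.≟ v
...   | yes _ | yes _ = refl
...   | no u≢u | _ = ⊥-elim (u≢u refl)
...   | yes _ | no v≢v = ⊥-elim (v≢v refl)

EdgesBefore : ℕ → Matching → Set
EdgesBefore t = All (λ e → proj₁ e < t × proj₂ e < t)

EdgesBefore-suc : ∀ {t M} → EdgesBefore t M → EdgesBefore (suc t) M
EdgesBefore-suc = All.map (λ { (a<t , b<t) → ℕ.m<n⇒m<1+n a<t , ℕ.m<n⇒m<1+n b<t })

EdgesBefore-tryMatch : ∀ {t w M} → w < t → EdgesBefore t M → EdgesBefore (suc t) (tryMatch w t M)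
EdgesBefore-tryMatch {t} {w} {M} w<t before with isFree w M
... | true = (ℕ.m<n⇒m<1+n w<t , ℕ.n<1+n t) ∷ EdgesBefore-suc before
... | false = EdgesBefore-suc before

EdgesBefore⇒isFree : ∀ {t M} → EdgesBefore t M → isFree t M ≡ true
EdgesBefore⇒isFree {M = []} [] = refl
EdgesBefore⇒isFree {t} {(a , b) ∷ M} ((a<t , b<t) ∷ before) =
  trans (isFree-∷ t a b M (ℕ.<⇒≢ a<t) (ℕ.<⇒≢ b<t)) (EdgesBefore⇒isFree before)

EdgesBefore⇒¬hasEdge : ∀ {t M} u → EdgesBefore t M → hasEdge u t M ≡ false
EdgesBefore⇒¬hasEdge {M = []} u [] = refl
EdgesBefore⇒¬hasEdge {t} {(a , b) ∷ M} u ((_ , b<t) ∷ before) =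
  trans (hasEdge-∷ u t a b M (inj₂ (ℕ.<⇒≢ b<t))) (EdgesBefore⇒¬hasEdge u before)

-- Pr D E unfolds to the sum of [ E M ]· p over the outcomes (p , M) of D.
[_]·_ : Bool → ℚ → ℚ
[ b ]· q = if b then q else 0ℚ

[]·-+ : ∀ b x y → [ b ]· x + [ b ]· y ≡ [ b ]· (x + y)
[]·-+ true x y = refl
[]·-+ false x y = +-identityˡ 0ℚ

[]·-*-comm : ∀ b p q → [ b ]· (p * q) ≡ q * [ b ]· p
[]·-*-comm true p q = *-comm p q
[]·-*-comm false p q = sym (*-zeroʳ q)

[]·-not : ∀ b p q → [ not b ]· (p * q) ≡ p * q - q * [ b ]· p
[]·-not true p q = sym (trans (cong (λ r → p * q - r) (*-comm q p)) (+-inverseʳ (p * q)))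
[]·-not false p q = sym (trans (cong (λ r → p * q - r) (*-zeroʳ q)) (+-identityʳ (p * q)))

sumℚ-map-[]· : ∀ {ws : List A} (h : A → Bool) b f → All (λ w → h w ≡ b) ws →
  sumℚ (map (λ w → [ h w ]· f w) ws) ≡ [ b ]· sumℚ (map f ws)
sumℚ-map-[]· {ws = ws} h b f h≡b =
  trans (sumℚ-map-cong (All.map (cong (λ c → [ c ]· _)) h≡b)) (const b)
  where
  const : ∀ b → sumℚ (map (λ w → [ b ]· f w) ws) ≡ [ b ]· sumℚ (map f ws)
  const true = refl
  const false = sumℚ-map-zero ws

Pr-concatMap : (g : A → Dist) (xs : List A) (E : Matching → Bool) →
  Pr (concatMap g xs) E ≡ sumℚ (map (λ x → Pr (g x) E) xs)
Pr-concatMap g [] E = refl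
Pr-concatMap g (x ∷ xs) E =
  trans (cong sumℚ (map-++ _ (g x) (concat (map g xs))))
        (trans (sumℚ-++ (map _ (g x)) _) (cong (Pr (g x) E +_) (Pr-concatMap g xs E)))

-- The step function of distAt, which is local to its definition there.
roundingStep : ℕ → List ℕ → (ℕ → ℚ) → ℚ × Matching → Dist
roundingStep t ws z (p , M) =
  (p * (1ℚ - sumℚ (map z ws)) , M) ∷ map (λ w → (p * z w , tryMatch w t M)) ws

distAt-suc : ∀ nbr θ t →
  distAt nbr θ (suc t) ≡ concatMap (roundingStep t (nbr t) (zval nbr θ t)) (distAt nbr θ t)
distAt-suc nbr θ t = cong concat (map-cong (λ { (p , M) → cong₂ _∷_
   (cong (λ s → (p * (1ℚ - s) , M)) (cong sumℚ (sym (map-∘ (nbr t)))))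
   (sym (map-∘ (nbr t))) }) (distAt nbr θ t))

module _ (t : ℕ) (ws : List ℕ) (z : ℕ → ℚ) (p : ℚ) (M : Matching) where

  Pr-roundingStep : ∀ E → Pr (roundingStep t ws z (p , M)) E ≡
    [ E M ]· (p * (1ℚ - sumℚ (map z ws))) + sumℚ (map (λ w → [ E (tryMatch w t M) ]· (p * z w)) ws)
  Pr-roundingStep E = cong ([ E M ]· (p * (1ℚ - sumℚ (map z ws))) +_) (cong sumℚ (sym (map-∘ ws)))

  Pr-roundingStep-stable : ∀ E → All (λ w → E (tryMatch w t M) ≡ E M) ws →
    Pr (roundingStep t ws z (p , M)) E ≡ [ E M ]· p
  Pr-roundingStep-stable E stable = begin
    Pr (roundingStep t ws z (p , M)) E
      ≡⟨ Pr-roundingStep E ⟩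
    [ E M ]· (p * (1ℚ - s)) + sumℚ (map (λ w → [ E (tryMatch w t M) ]· (p * z w)) ws)
      ≡⟨ cong ([ E M ]· (p * (1ℚ - s)) +_) (sumℚ-map-[]· (λ w → E (tryMatch w t M)) (E M) (λ w → p * z w) stable) ⟩
    [ E M ]· (p * (1ℚ - s)) + [ E M ]· sumℚ (map (λ w → p * z w) ws)
      ≡⟨ []·-+ (E M) _ _ ⟩
    [ E M ]· (p * (1ℚ - s) + sumℚ (map (λ w → p * z w) ws))
      ≡⟨ cong (λ r → [ E M ]· (p * (1ℚ - s) + r)) (sumℚ-map-*ˡ p z ws) ⟩
    [ E M ]· (p * (1ℚ - s) + p * s)
      ≡⟨ cong ([ E M ]·_) (recombine p s) ⟩
    [ E M ]· p ∎
    where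
    open ≡-Reasoning
    s = sumℚ (map z ws)
    recombine : ∀ p s → p * (1ℚ - s) + p * s ≡ p
    recombine = solve-∀ ℚ-ring

  Pr-roundingStep-isFree-nbr : ∀ u → Unique ws → u ∈ ws → t ≢ u →
    Pr (roundingStep t ws z (p , M)) (isFree u) ≡ (1ℚ - z u) * [ isFree u M ]· p
  Pr-roundingStep-isFree-nbr u unique u∈ws t≢u
    rewrite Pr-roundingStep (isFree u) with isFree u M in free
  ... | true = begin
    p * (1ℚ - s) + sumℚ (map (λ w → [ isFree u (tryMatch w t M) ]· (p * z w)) ws)
      ≡⟨ cong (p * (1ℚ - s) +_) (sumℚ-map-≡-except _ (λ w → p * z w) ws unique u∈ws stays-free) ⟩
    p * (1ℚ - s) + (sumℚ (map (λ w → p * z w) ws) - p * z u + [ isFree u (tryMatch u t M) ]· (p * z u))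
      ≡⟨ cong₂ (λ r c → p * (1ℚ - s) + (r - p * z u + [ c ]· (p * z u)))
               (sumℚ-map-*ˡ p z ws) (isFree-tryMatch-self u t M) ⟩
    p * (1ℚ - s) + (p * s - p * z u + 0ℚ)
      ≡⟨ collect p s (z u) ⟩
    (1ℚ - z u) * p ∎
    where
    open ≡-Reasoning
    s = sumℚ (map z ws)
    stays-free : ∀ w → w ≢ u → [ isFree u (tryMatch w t M) ]· (p * z w) ≡ p * z w
    stays-free w w≢u = cong (λ c → [ c ]· (p * z w)) (trans (isFree-tryMatch-other u w t M w≢u t≢u) free)
    collect : ∀ p s zu → p * (1ℚ - s) + (p * s - p * zu + 0ℚ) ≡ (1ℚ - zu) * p
    collect = solve-∀ ℚ-ring
  ... | false = trans (cong (0ℚ +_) (sumℚ-map-[]· _ false (λ w → p * z w)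
                        (All.universal (isFree-tryMatch-matched u t M free t≢u) ws)))
                      (sym (*-zeroʳ (1ℚ - z u)))

  Pr-roundingStep-isFree-arrival : isFree t M ≡ true →
    Pr (roundingStep t ws z (p , M)) (isFree t) ≡ [ isFree t M ]· p - sumℚ (map (λ w → z w * [ isFree w M ]· p) ws)
  Pr-roundingStep-isFree-arrival free rewrite Pr-roundingStep (isFree t) | free = begin
    p * (1ℚ - s) + sumℚ (map (λ w → [ isFree t (tryMatch w t M) ]· (p * z w)) ws)
      ≡⟨ cong (p * (1ℚ - s) +_) (sumℚ-map-cong′ ws (λ w →
           trans (cong (λ c → [ c ]· (p * z w)) (isFree-tryMatch-arrival w t M free)) ([]·-not (isFree w M) p (z w)))) ⟩
    p * (1ℚ - s) + sumℚ (map (λ w → p * z w - z w * [ isFree w M ]· p) ws)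
      ≡⟨ cong (p * (1ℚ - s) +_) (sumℚ-map-- (λ w → p * z w) _ ws) ⟩
    p * (1ℚ - s) + (sumℚ (map (λ w → p * z w) ws) - lost)
      ≡⟨ cong (λ r → p * (1ℚ - s) + (r - lost)) (sumℚ-map-*ˡ p z ws) ⟩
    p * (1ℚ - s) + (p * s - lost)
      ≡⟨ collect p s lost ⟩
    p - lost ∎
    where
    open ≡-Reasoning
    s = sumℚ (map z ws)
    lost = sumℚ (map (λ w → z w * [ isFree w M ]· p) ws)
    collect : ∀ p s l → p * (1ℚ - s) + (p * s - l) ≡ p - l
    collect = solve-∀ ℚ-ring

  Pr-roundingStep-hasEdge : ∀ u → Unique ws → u ∈ ws → hasEdge u t M ≡ false →
    Pr (roundingStep t ws z (p , M)) (hasEdge u t) ≡ z u * [ isFree u M ]· p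
  Pr-roundingStep-hasEdge u unique u∈ws absent rewrite Pr-roundingStep (hasEdge u t) | absent = begin
    0ℚ + sumℚ (map (λ w → [ hasEdge u t (tryMatch w t M) ]· (p * z w)) ws)
      ≡⟨ +-identityˡ _ ⟩
    sumℚ (map (λ w → [ hasEdge u t (tryMatch w t M) ]· (p * z w)) ws)
      ≡⟨ sumℚ-map-≡-except _ (λ _ → 0ℚ) ws unique u∈ws (λ w w≢u →
           cong (λ c → [ c ]· (p * z w)) (trans (hasEdge-tryMatch-other u t w t M (inj₁ w≢u)) absent)) ⟩
    sumℚ (map (λ _ → 0ℚ) ws) - 0ℚ + [ hasEdge u t (tryMatch u t M) ]· (p * z u)
      ≡⟨ cong₂ (λ r c → r - 0ℚ + [ c ]· (p * z u)) (sumℚ-map-zero ws) (hasEdge-tryMatch-self u t M absent) ⟩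
    0ℚ - 0ℚ + [ isFree u M ]· (p * z u)
      ≡⟨ +-identityˡ _ ⟩
    [ isFree u M ]· (p * z u)
      ≡⟨ []·-*-comm (isFree u M) p (z u) ⟩
    z u * [ isFree u M ]· p ∎
    where open ≡-Reasoning

module RoundingProcess (nbr : Arrivals) (θ : ℕ → ℚ) (nbr<v : ∀ v → All (_< v) (nbr v)) where

  private
    D : ℕ → Dist
    D = distAt nbr θ
    z : ℕ → ℕ → ℚ
    z = zval nbr θ

  distAt-EdgesBefore : ∀ t → All (λ pM → EdgesBefore t (proj₂ pM)) (D t)
  distAt-EdgesBefore zero = [] ∷ []
  distAt-EdgesBefore (suc t) rewrite distAt-suc nbr θ t =
    concat⁺ (map⁺ (All.map (λ {pM} → step pM) (distAt-EdgesBefore t)))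
    where
    step : ∀ pM → EdgesBefore t (proj₂ pM) →
      All (λ qM → EdgesBefore (suc t) (proj₂ qM)) (roundingStep t (nbr t) (z t) pM)
    step _ before = EdgesBefore-suc before ∷ map⁺ (All.map (λ w<t → EdgesBefore-tryMatch w<t before) (nbr<v t))

  Pr-distAt-suc : ∀ t E →
    Pr (D (suc t)) E ≡ sumℚ (map (λ pM → Pr (roundingStep t (nbr t) (z t) pM) E) (D t))
  Pr-distAt-suc t E rewrite distAt-suc nbr θ t = Pr-concatMap _ (D t) E

  Pr-distAt-suc-stable : ∀ t E → (∀ w M → w ∈ nbr t → E (tryMatch w t M) ≡ E M) →
    Pr (D (suc t)) E ≡ Pr (D t) E
  Pr-distAt-suc-stable t E stable = trans (Pr-distAt-suc t E) (sumℚ-map-cong′ (D t) λ (p , M) →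
    Pr-roundingStep-stable t (nbr t) (z t) p M E (All.tabulate (stable _ M)))

  Pr-distAt-suc-isFree-nbr : ∀ t u → Unique (nbr t) → u ∈ nbr t →
    Pr (D (suc t)) (isFree u) ≡ (1ℚ - z t u) * Pr (D t) (isFree u)
  Pr-distAt-suc-isFree-nbr t u unique u∈ = trans (Pr-distAt-suc t (isFree u))
    (trans (sumℚ-map-cong′ (D t) λ (p , M) →
              Pr-roundingStep-isFree-nbr t (nbr t) (z t) p M u unique u∈ (λ t≡u → ℕ.<⇒≢ (All.lookup (nbr<v t) u∈) (sym t≡u)))
           (sumℚ-map-*ˡ (1ℚ - z t u) (λ pM → [ isFree u (proj₂ pM) ]· proj₁ pM) (D t)))

  Pr-distAt-suc-isFree-arrival : ∀ t →
    Pr (D (suc t)) (isFree t) ≡ Pr (D t) (isFree t) - sumℚ (map (λ w → z t w * Pr (D t) (isFree w)) (nbr t))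
  Pr-distAt-suc-isFree-arrival t = begin
    Pr (D (suc t)) (isFree t)
      ≡⟨ Pr-distAt-suc t (isFree t) ⟩
    sumℚ (map (λ pM → Pr (roundingStep t (nbr t) (z t) pM) (isFree t)) (D t))
      ≡⟨ sumℚ-map-cong (All.map (λ {(p , M)} before →
           Pr-roundingStep-isFree-arrival t (nbr t) (z t) p M (EdgesBefore⇒isFree before)) (distAt-EdgesBefore t)) ⟩
    sumℚ (map (λ pM → [ isFree t (proj₂ pM) ]· proj₁ pM - lost pM) (D t))
      ≡⟨ sumℚ-map-- (λ pM → [ isFree t (proj₂ pM) ]· proj₁ pM) lost (D t) ⟩
    Pr (D t) (isFree t) - sumℚ (map lost (D t))
      ≡⟨ cong (_-_ (Pr (D t) (isFree t))) (sumℚ-map-swap (λ pM w → z t w * [ isFree w (proj₂ pM) ]· proj₁ pM) (D t) (nbr t)) ⟩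
    Pr (D t) (isFree t) - sumℚ (map (λ w → sumℚ (map (λ pM → z t w * [ isFree w (proj₂ pM) ]· proj₁ pM) (D t))) (nbr t))
      ≡⟨ cong (_-_ (Pr (D t) (isFree t))) (sumℚ-map-cong′ (nbr t) λ w →
           sumℚ-map-*ˡ (z t w) (λ pM → [ isFree w (proj₂ pM) ]· proj₁ pM) (D t)) ⟩
    Pr (D t) (isFree t) - sumℚ (map (λ w → z t w * Pr (D t) (isFree w)) (nbr t)) ∎
    where
    open ≡-Reasoning
    lost : ℚ × Matching → ℚ
    lost (p , M) = sumℚ (map (λ w → z t w * [ isFree w M ]· p) (nbr t))

  Pr-distAt-suc-hasEdge : ∀ u v → Unique (nbr v) → u ∈ nbr v →
    Pr (D (suc v)) (hasEdge u v) ≡ z v u * Pr (D v) (isFree u)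
  Pr-distAt-suc-hasEdge u v unique u∈ = trans (Pr-distAt-suc v (hasEdge u v))
    (trans (sumℚ-map-cong (All.map (λ {(p , M)} before →
              Pr-roundingStep-hasEdge v (nbr v) (z v) p M u unique u∈ (EdgesBefore⇒¬hasEdge u before))
              (distAt-EdgesBefore v)))
           (sumℚ-map-*ˡ (z v u) (λ pM → [ isFree u (proj₂ pM) ]· proj₁ pM) (D v)))

module FractionalAlgorithm (nbr : Arrivals) (θ : ℕ → ℚ) (nbr<v : ∀ v → All (_< v) (nbr v))
                           (largest : ∀ t → IsLargestθ nbr θ t) where

  y : ℕ → ℕ → ℚ
  y = yAt nbr θ

  θ≤1 : ∀ t → θ t ≤ 1ℚ
  θ≤1 t = proj₁ (largest t)

  θ-feasible : ∀ t → excess (y t) (nbr t) (θ t) ≤ 1ℚ - θ t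
  θ-feasible t = proj₁ (proj₂ (largest t))

  θ-maximal : ∀ t b → b ≤ 1ℚ → excess (y t) (nbr t) b ≤ 1ℚ - b → b ≤ θ t
  θ-maximal t = proj₂ (proj₂ (largest t))

  y-suc-nbr : ∀ t u → u ∈ nbr t → y (suc t) u ≡ y t u ⊔ θ t
  y-suc-nbr t u u∈ with u ∈? nbr t
  ... | yes _ = refl
  ... | no u∉ = ⊥-elim (u∉ u∈)

  y-suc-arrival : ∀ t → y (suc t) t ≡ 1ℚ - θ t
  y-suc-arrival t with t ∈? nbr t | t ℕ.≟ t
  ... | yes t∈ | _ = ⊥-elim (ℕ.<-irrefl refl (All.lookup (nbr<v t) t∈))
  ... | no _ | yes _ = refl
  ... | no _ | no t≢t = ⊥-elim (t≢t refl)

  y-suc-other : ∀ t u → ¬ u ∈ nbr t → u ≢ t → y (suc t) u ≡ y t u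
  y-suc-other t u u∉ u≢t with u ∈? nbr t | u ℕ.≟ t
  ... | yes u∈ | _ = ⊥-elim (u∉ u∈)
  ... | no _ | yes u≡t = ⊥-elim (u≢t u≡t)
  ... | no _ | no _ = refl

  y-unarrived : ∀ t u → t ℕ.≤ u → y t u ≡ 0ℚ
  y-unarrived zero u _ = refl
  y-unarrived (suc t) u t<u = trans
    (y-suc-other t u (λ u∈ → ℕ.<-irrefl refl (ℕ.<-trans (All.lookup (nbr<v t) u∈) t<u))
                     (λ u≡t → ℕ.<-irrefl (sym u≡t) t<u))
    (y-unarrived t u (ℕ.<⇒≤ t<u))

  θ≡1⇒⁺≡0 : ∀ t → θ t ≡ 1ℚ → All (λ u → (θ t - y t u) ⁺ ≡ 0ℚ) (nbr t)
  θ≡1⇒⁺≡0 t θ≡1 = sumℚ-map-nonNeg-≤0 (All.universal (λ u → ⁺-nonNeg (θ t - y t u)) (nbr t))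
    (subst (excess (y t) (nbr t) (θ t) ≤_) (trans (cong (_-_ 1ℚ) θ≡1) (+-inverseʳ 1ℚ)) (θ-feasible t))

  excess-θ : ∀ t → excess (y t) (nbr t) (θ t) ≡ 1ℚ - θ t
  excess-θ t with ≤⇒≡⊎< (θ≤1 t)
  ... | inj₁ θ≡1 = trans (sumℚ-map-cong (θ≡1⇒⁺≡0 t θ≡1))
                         (trans (sumℚ-map-zero (nbr t)) (sym (trans (cong (_-_ 1ℚ) θ≡1) (+-inverseʳ 1ℚ))))
  ... | inj₂ θ<1 = ≤-antisym (θ-feasible t) (≮⇒≥ no-slack)
    where
    0≤K : 0ℚ ≤ sumℚ (map (λ _ → 1ℚ) (nbr t))
    0≤K = sumℚ-map-nonNeg (All.universal (λ _ → <⇒≤ (positive⁻¹ 1ℚ)) (nbr t))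
    no-slack : ¬ excess (y t) (nbr t) (θ t) <ℚ 1ℚ - θ t
    no-slack slack =
      let b , θ<b , b≤1 , b-feasible = slack⇒larger-feasible (excess (y t) (nbr t)) _ (θ t) 0≤K
                                         (excess-nonNeg (y t) (nbr t) (θ t)) (excess-+-≤ (y t) (nbr t) (θ t)) slack
      in <-irrefl refl (<-≤-trans θ<b (θ-maximal t b b≤1 b-feasible))

  -- With β = 2 and f(θ) = 1 − θ, the factor (1 + (1 − θ)/f(θ))/β is 1 unless θ = 1 (where x⁺ = 0 anyway).
  xval≡⁺ : ∀ t u → u ∈ nbr t → xval nbr θ u t ≡ (θ t - y t u) ⁺
  xval≡⁺ t u u∈ with ≤⇒≡⊎< (θ≤1 t)
  ... | inj₁ θ≡1 rewrite All.lookup (θ≡1⇒⁺≡0 t θ≡1) u∈ = trans (cong (_* r) (*-zeroˡ ½)) (*-zeroˡ r)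
    where r = 1ℚ + ((1ℚ - θ t) ÷₀ f (θ t))
  ... | inj₂ θ<1 = trans (cong (λ r → (q * ½) * (1ℚ + r)) (÷₀-self 1-θ≢0))
                         (trans (*-assoc q ½ (1ℚ + 1ℚ)) (*-identityʳ q))
    where
    q = (θ t - y t u) ⁺
    1-θ≢0 : 1ℚ - θ t ≢ 0ℚ
    1-θ≢0 1-θ≡0 = <-irrefl (sym 1-θ≡0) (<⇒0<- θ<1)

  sum-xval : ∀ t → sumℚ (map (λ w → xval nbr θ w t) (nbr t)) ≡ 1ℚ - θ t
  sum-xval t = trans (sumℚ-map-cong (All.tabulate (xval≡⁺ t _))) (excess-θ t)

  xval-nonNeg : ∀ t u → u ∈ nbr t → 0ℚ ≤ xval nbr θ u t
  xval-nonNeg t u u∈ = subst (0ℚ ≤_) (sym (xval≡⁺ t u u∈)) (⁺-nonNeg (θ t - y t u))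

  θ≤y⇒xval≡0 : ∀ t u → u ∈ nbr t → θ t ≤ y t u → xval nbr θ u t ≡ 0ℚ
  θ≤y⇒xval≡0 t u u∈ θ≤y = trans (xval≡⁺ t u u∈) (nonPos⇒⁺≡0 (≤⇒-≤0 θ≤y))

  -- 1 − y_u = 0 forces y_u = 1 ≥ θ, hence x_{ut} = 0.
  xval-÷₀-*-cancel : ∀ t u → u ∈ nbr t → (xval nbr θ u t ÷₀ (1ℚ - y t u)) * (1ℚ - y t u) ≡ xval nbr θ u t
  xval-÷₀-*-cancel t u u∈ = ÷₀-*-cancel _ _ λ 1-y≡0 →
    θ≤y⇒xval≡0 t u u∈ (subst (θ t ≤_) (sym (y≡1 1-y≡0)) (θ≤1 t))
    where
    cancel : ∀ y → y + (1ℚ - y) ≡ 1ℚ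
    cancel = solve-∀ ℚ-ring
    y≡1 : 1ℚ - y t u ≡ 0ℚ → y t u ≡ 1ℚ
    y≡1 1-y≡0 = trans (sym (+-identityʳ (y t u))) (trans (cong (y t u +_) (sym 1-y≡0)) (cancel (y t u)))

module Rounding (nbr : Arrivals) (θ : ℕ → ℚ) (nbr<v : ∀ v → All (_< v) (nbr v))
                (unique : ∀ v → Unique (nbr v)) (largest : ∀ t → IsLargestθ nbr θ t) where

  open FractionalAlgorithm nbr θ nbr<v largest
  open RoundingProcess nbr θ nbr<v

  private
    D : ℕ → Dist
    D = distAt nbr θ
    z : ℕ → ℕ → ℚ
    z = zval nbr θ

  Pr-isFree : ∀ t u → Pr (D t) (isFree u) ≡ 1ℚ - y t u
  zval-*-Pr-isFree : ∀ t u → u ∈ nbr t → z t u * Pr (D t) (isFree u) ≡ xval nbr θ u t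

  zval-*-Pr-isFree t u u∈ =
    trans (cong (λ P → (xval nbr θ u t ÷₀ P) * P) (Pr-isFree t u)) (xval-÷₀-*-cancel t u u∈)

  Pr-isFree zero u = refl
  Pr-isFree (suc t) u = by-case u (u ∈? nbr t) (u ℕ.≟ t)
    where
    by-case : ∀ u → Dec (u ∈ nbr t) → Dec (u ≡ t) → Pr (D (suc t)) (isFree u) ≡ 1ℚ - y (suc t) u
    by-case u (yes u∈) _ = begin
      Pr (D (suc t)) (isFree u)                   ≡⟨ Pr-distAt-suc-isFree-nbr t u (unique t) u∈ ⟩
      (1ℚ - z t u) * Pr (D t) (isFree u)          ≡⟨ distrib (z t u) _ ⟩
      Pr (D t) (isFree u) - z t u * Pr (D t) (isFree u)
                                                  ≡⟨ cong₂ _-_ (Pr-isFree t u) (zval-*-Pr-isFree t u u∈) ⟩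
      (1ℚ - y t u) - xval nbr θ u t               ≡⟨ cong (_-_ (1ℚ - y t u)) (xval≡⁺ t u u∈) ⟩
      (1ℚ - y t u) - (θ t - y t u) ⁺              ≡⟨ c-y-[θ-y]⁺≡c-y⊔θ 1ℚ (y t u) (θ t) ⟩
      1ℚ - (y t u ⊔ θ t)                          ≡⟨ cong (_-_ 1ℚ) (y-suc-nbr t u u∈) ⟨
      1ℚ - y (suc t) u                            ∎
      where
      open ≡-Reasoning
      distrib : ∀ z P → (1ℚ - z) * P ≡ P - z * P
      distrib = solve-∀ ℚ-ring
    by-case u (no _) (yes refl) = begin
      Pr (D (suc t)) (isFree t)         ≡⟨ Pr-distAt-suc-isFree-arrival t ⟩
      Pr (D t) (isFree t) - sumℚ (map (λ w → z t w * Pr (D t) (isFree w)) (nbr t))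
        ≡⟨ cong₂ _-_ (trans (Pr-isFree t t) (cong (_-_ 1ℚ) (y-unarrived t t ℕ.≤-refl)))
                     (sumℚ-map-cong (All.tabulate (zval-*-Pr-isFree t _))) ⟩
      1ℚ - sumℚ (map (λ w → xval nbr θ w t) (nbr t))
                                        ≡⟨ cong (_-_ 1ℚ) (sum-xval t) ⟩
      1ℚ - (1ℚ - θ t)                   ≡⟨ cong (_-_ 1ℚ) (y-suc-arrival t) ⟨
      1ℚ - y (suc t) t                  ∎
      where open ≡-Reasoning
    by-case u (no u∉) (no u≢t) =
      trans (Pr-distAt-suc-stable t (isFree u) λ w M w∈ →
               isFree-tryMatch-other u w t M (λ w≡u → u∉ (subst (_∈ nbr t) w≡u w∈)) (λ t≡u → u≢t (sym t≡u)))
            (trans (Pr-isFree t u) (cong (_-_ 1ℚ) (sym (y-suc-other t u u∉ u≢t))))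

  xval≡0⇒zval≡0 : ∀ v u → xval nbr θ u v ≡ 0ℚ → z v u ≡ 0ℚ
  xval≡0⇒zval≡0 v u x≡0 = trans (cong (_÷₀ Pr (D v) (isFree u)) x≡0) (÷₀-zeroˡ (Pr (D v) (isFree u)))

  θ≤y⇒zval≡0 : ∀ v u → u ∈ nbr v → θ v ≤ y v u → z v u ≡ 0ℚ
  θ≤y⇒zval≡0 v u u∈ θ≤y = xval≡0⇒zval≡0 v u (θ≤y⇒xval≡0 v u u∈ θ≤y)

  zval-nonNeg : ∀ v u → u ∈ nbr v → 0ℚ ≤ z v u
  zval-nonNeg v u u∈ with ≤-total (θ v) (y v u)
  ... | inj₁ θ≤y = ≤-reflexive (sym (θ≤y⇒zval≡0 v u u∈ θ≤y))
  ... | inj₂ y≤θ = ÷₀-nonNeg (xval-nonNeg v u u∈)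
                             (subst (0ℚ ≤_) (sym (Pr-isFree v u)) (≤⇒0≤- (≤-trans y≤θ (θ≤1 v))))

  zval-*-≤-xval : ∀ v u → u ∈ nbr v → z v u * (1ℚ - θ v) ≤ xval nbr θ u v
  zval-*-≤-xval v u u∈ with ≤-total (θ v) (y v u)
  ... | inj₁ θ≤y = subst (_≤ xval nbr θ u v) (sym (trans (cong (_* (1ℚ - θ v)) (θ≤y⇒zval≡0 v u u∈ θ≤y)) (*-zeroˡ (1ℚ - θ v))))
                         (xval-nonNeg v u u∈)
  ... | inj₂ y≤θ = begin
    z v u * (1ℚ - θ v)          ≤⟨ *-monoˡ-≤-nonNeg (z v u) {{nonNegative (zval-nonNeg v u u∈)}}
                                     (+-monoʳ-≤ 1ℚ (neg-antimono-≤ y≤θ)) ⟩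
    z v u * (1ℚ - y v u)        ≡⟨ cong (z v u *_) (Pr-isFree v u) ⟨
    z v u * Pr (D v) (isFree u) ≡⟨ zval-*-Pr-isFree v u u∈ ⟩
    xval nbr θ u v              ∎
    where open ≤-Reasoning

  sum-zval≤1 : ∀ v → sumℚ (map (z v) (nbr v)) ≤ 1ℚ
  sum-zval≤1 v with ≤⇒≡⊎< (θ≤1 v)
  ... | inj₁ θ≡1 = subst (_≤ 1ℚ) (sym sum≡0) (<⇒≤ (positive⁻¹ 1ℚ))
    where
    sum≡0 : sumℚ (map (z v) (nbr v)) ≡ 0ℚ
    sum≡0 = trans (sumℚ-map-cong (All.tabulate λ {u} u∈ →
              xval≡0⇒zval≡0 v u (trans (xval≡⁺ v u u∈) (All.lookup (θ≡1⇒⁺≡0 v θ≡1) u∈))))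
              (sumℚ-map-zero (nbr v))
  ... | inj₂ θ<1 = *-cancelʳ-≤-pos (1ℚ - θ v) {{positive (<⇒0<- θ<1)}} (begin
    sumℚ (map (z v) (nbr v)) * (1ℚ - θ v)
      ≡⟨ *-comm _ (1ℚ - θ v) ⟩
    (1ℚ - θ v) * sumℚ (map (z v) (nbr v))
      ≡⟨ sumℚ-map-*ˡ (1ℚ - θ v) (z v) (nbr v) ⟨
    sumℚ (map (λ u → (1ℚ - θ v) * z v u) (nbr v))
      ≡⟨ sumℚ-map-cong′ (nbr v) (λ u → *-comm (1ℚ - θ v) (z v u)) ⟩
    sumℚ (map (λ u → z v u * (1ℚ - θ v)) (nbr v))
      ≤⟨ sumℚ-map-mono-≤ (All.tabulate (zval-*-≤-xval v _)) ⟩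
    sumℚ (map (λ u → xval nbr θ u v) (nbr v))
      ≡⟨ sum-xval v ⟩
    1ℚ - θ v
      ≡⟨ *-identityˡ (1ℚ - θ v) ⟨
    1ℚ * (1ℚ - θ v) ∎)
    where open ≤-Reasoning

  Pr-hasEdge : ∀ u v → u ∈ nbr v → ∀ n → v < n → Pr (D n) (hasEdge u v) ≡ xval nbr θ u v
  Pr-hasEdge u v u∈ (suc m) v<1+m with ℕ.m<1+n⇒m<n∨m≡n v<1+m
  ... | inj₂ refl = trans (Pr-distAt-suc-hasEdge u v (unique v) u∈) (zval-*-Pr-isFree v u u∈)
  ... | inj₁ v<m = trans (Pr-distAt-suc-stable m (hasEdge u v) λ w M _ →
                           hasEdge-tryMatch-other u v w m M (inj₂ (λ m≡v → ℕ.<⇒≢ v<m (sym m≡v))))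
                         (Pr-hasEdge u v u∈ m v<m)

lemma3 : (n : ℕ) (nbr : Arrivals) (θ : ℕ → ℚ) →
    (∀ v → All (_< v) (nbr v)) →
    (∀ v → Unique (nbr v)) →
    (∀ t → IsLargestθ nbr θ t) →
    ∀ v → v < n →
    ((∀ u → u ∈ nbr v → 0ℚ ≤ zval nbr θ v u) ×
    (sumℚ (map (zval nbr θ v) (nbr v)) ≤ 1ℚ)) ×
    (∀ u → u ∈ nbr v → Pr (distAt nbr θ n) (hasEdge u v) ≡ xval nbr θ u v)
lemma3 n nbr θ nbr<v unique largest v v<n =
  (zval-nonNeg v , sum-zval≤1 v) , λ u u∈ → Pr-hasEdge u v u∈ n v<n
  where open Rounding nbr θ nbr<v unique largest
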